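{- Let $G_T=(V_T,E_T)$ and $G_W=(V_W,E_W)$ be graphs, and let $V_T=C_1\cup\cdots\cup C_n$ be the partition of $V_T$ into structural equivalence classes of $G_T$. If there exists at least one subgraph isomorphism from $G_T$ to $G_W$, then there are at least $\prod_{i=1}^n |C_i|!$ subgraph isomorphisms from $G_T$ to $G_W$.
   Context: A graph is a pair $G=(V,E)$ with $V$ a finite set and $E\subseteq V\times V$ a set of ordered pairs (directed edges), with no self-loops. A subgraph isomorphism from $G_T$ to $G_W$ is an injective map $f:V_T\to V_W$ such that $(t_1,t_2)\in E_T$ implies $(f(t_1),f(t_2))\in E_W$. Two vertices $v,w$ of $G=(V,E)$ are structurally equivalent ($v\sim_s w$) if (1) for every $u\in V\setminus\{v,w\}$: $(u,v)\in E\Leftrightarrow(u,w)\in E$ and $(v,u)\in E\Leftrightarrow(w,u)\in E$; and (2) $(v,w)\in E\Leftrightarrow(w,v)\in E$. This is an equivalence relation; its classes are the structural equivalence classes. -}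

module Defs where

open import Data.Nat using (ℕ; zero; suc; _*_; _≤_; _!)
open import Data.Nat.ListAction using (product)
open import Data.Fin using (Fin; _≟_)
open import Data.List using (List; length; filter; allFin; map)
open import Data.Product using (Σ; _×_; ∃; _,_)
open import Relation.Binary.PropositionalEquality using (_≡_; _≢_)
open import Relation.Nullary using (¬_)
open import Function using (_⇔_)
open import Function.Definitions using (Injective)
open import Level using (0ℓ; suc)

record Graph : Set₁ where
  field
    size : ℕ
    E    : Fin size → Fin size → Set
    loopless : ∀ v → ¬ E v v
open Graph public

IsSubIso : (T W : Graph) → (Fin (size T) → Fin (size W)) → Set
IsSubIso T W f =
  Injective _≡_ _≡_ f × (∀ t₁ t₂ → E T t₁ t₂ → E W (f t₁) (f t₂))

SubIso : (T W : Graph) → Set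
SubIso T W = Σ (Fin (size T) → Fin (size W)) (IsSubIso T W)

StructEq : (G : Graph) → Fin (size G) → Fin (size G) → Set
StructEq G v w =
  (∀ u → u ≢ v → u ≢ w →
     ((E G u v ⇔ E G u w) × (E G v u ⇔ E G w u)))
  × (E G v w ⇔ E G w v)

-- A labelling c : Fin (size G) → Fin k whose fibres are exactly the
-- structural equivalence classes C_1, …, C_k (each nonempty).
IsClassPartition : (G : Graph) (k : ℕ) → (Fin (size G) → Fin k) → Set
IsClassPartition G k c =
  (∀ i → ∃ λ v → c v ≡ i)
  × (∀ v w → (c v ≡ c w ⇔ StructEq G v w))

classSize : ∀ {m k} → (Fin m → Fin k) → Fin k → ℕ
classSize {m} c i = length (filter (λ v → c v ≟ i) (allFin m))

prodFact : ∀ {m k} → (Fin m → Fin k) → ℕ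
prodFact {m} {k} c = product (map (λ i → classSize c i !) (allFin k))

{-# OPTIONS --safe #-}
-- Swapping two structurally equivalent vertices is an automorphism of G_T, so the
-- product of the symmetric groups of the classes acts on G_T by automorphisms, and
-- precomposing one subgraph isomorphism f with these ∏ |C_i|! automorphisms gives
-- pairwise different subgraph isomorphisms, because f is injective.  The automorphisms
-- of one class are built inductively: every permutation of x ∷ L is a transposition
-- (x y) with y ∈ x ∷ L after a permutation of L.
module Submission where

open import Defs
open import Data.Nat using (ℕ; suc; _*_; _!)
open import Data.Nat.ListAction using (product)
open import Data.Fin using (Fin; zero; suc; _≟_; remQuot; combine)
open import Data.Fin.Properties using (combine-remQuot)
open import Data.Fin.Permutation.Components using (transpose; transpose-inverse)
open import Data.List using (List; []; _∷_; length; filter; allFin; map; lookup)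
open import Data.List.Membership.Propositional using (_∈_)
open import Data.List.Membership.Propositional.Properties using (∈-filter⁻; ∈-lookup)
open import Data.List.Relation.Unary.Any using (here; there)
open import Data.List.Relation.Unary.All.Properties using (All¬⇒¬Any)
open import Data.List.Relation.Unary.AllPairs using (_∷_)
open import Data.List.Relation.Unary.Unique.Propositional using (Unique)
open import Data.List.Relation.Unary.Unique.Propositional.Properties using (allFin⁺; filter⁺)
open import Data.Product using (Σ; _×_; _,_; proj₁; proj₂; uncurry)
open import Data.Product.Properties using (×-≡,≡→≡)
open import Data.Sum using (inj₁; inj₂)
open import Data.Empty using (⊥-elim)
open import Relation.Nullary using (¬_; yes; no; contradiction)
open import Relation.Unary using (Pred; _⊆_; _∪_; ∁)
open import Relation.Binary.PropositionalEquality
  using (_≡_; _≢_; refl; sym; trans; cong; subst; module ≡-Reasoning)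
open import Function using (_∘_; id; Equivalence)
open import Function.Definitions using (Injective)
open import Level using (0ℓ)

open Equivalence using (to; from)

lookup-injective : ∀ {A : Set} {xs : List A} → Unique xs → Injective _≡_ _≡_ (lookup xs)
lookup-injective {xs = _ ∷ _}  _           {zero}  {zero}  _  = refl
lookup-injective {xs = _ ∷ xs} (x∉xs ∷ _) {zero}  {suc j} eq =
  contradiction (subst (_∈ xs) (sym eq) (∈-lookup j)) (All¬⇒¬Any x∉xs)
lookup-injective {xs = _ ∷ xs} (x∉xs ∷ _) {suc i} {zero}  eq =
  contradiction (subst (_∈ xs) eq (∈-lookup i)) (All¬⇒¬Any x∉xs)
lookup-injective {xs = _ ∷ _}  (_ ∷ u)    {suc i} {suc j} eq =
  cong suc (lookup-injective u eq)

remQuot-injective : ∀ {m} n → Injective _≡_ _≡_ (remQuot {m} n)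
remQuot-injective {m} n {i} {j} eq = begin
  i                                 ≡⟨ combine-remQuot {m} n i ⟨
  uncurry combine (remQuot {m} n i) ≡⟨ cong (uncurry combine) eq ⟩
  uncurry combine (remQuot {m} n j) ≡⟨ combine-remQuot {m} n j ⟩
  j                                 ∎
  where open ≡-Reasoning

transpose-injective : ∀ {n} (i j : Fin n) → Injective _≡_ _≡_ (transpose i j)
transpose-injective i j {k} {l} eq = begin
  k                               ≡⟨ transpose-inverse j i ⟨
  transpose j i (transpose i j k) ≡⟨ cong (transpose j i) eq ⟩
  transpose j i (transpose i j l) ≡⟨ transpose-inverse j i ⟩
  l                               ∎
  where open ≡-Reasoning

transpose-matchˡ : ∀ {n} (i j : Fin n) → transpose i j i ≡ j
transpose-matchˡ i j with i ≟ i
... | yes _   = refl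
... | no i≢i = contradiction refl i≢i

transpose-other : ∀ {n} {i j k : Fin n} → k ≢ i → k ≢ j → transpose i j k ≡ k
transpose-other {i = i} {j} {k} k≢i k≢j with k ≟ i
... | yes k≡i = contradiction k≡i k≢i
... | no _ with k ≟ j
...   | yes k≡j = contradiction k≡j k≢j
...   | no _    = refl

Separates : ∀ {I A B : Set} → Pred A 0ℓ → (I → A → B) → Set
Separates S σ = ∀ i j → (∀ {v} → S v → σ i v ≡ σ j v) → i ≡ j

module _ {I A B : Set} {σ : I → A → B} where

  Separates-mono : ∀ {S S′ : Pred A 0ℓ} → S ⊆ S′ → Separates S σ → Separates S′ σ
  Separates-mono S⊆S′ sep i j agree = sep i j (agree ∘ S⊆S′)

  Separates-reindex : ∀ {J} {r : J → I} {S} → Injective _≡_ _≡_ r → Separates S σ → Separates S (σ ∘ r)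
  Separates-reindex r-inj sep i j agree = r-inj (sep _ _ agree)

-- α a ∘ β b determines a by its values on X, where β b is the identity, and then,
-- α a being injective, b by its values on Y.
Separates-∘ : ∀ {A : Set} {I J} {α : I → A → A} {β : J → A → A} {X Y : Pred A 0ℓ} →
  (∀ a → Injective _≡_ _≡_ (α a)) → (∀ b {v} → X v → β b v ≡ v) →
  Separates X α → Separates Y β → Separates (X ∪ Y) (λ (p : I × J) → α (proj₁ p) ∘ β (proj₂ p))
Separates-∘ {α = α} {β} {Y = Y} α-inj β-fixes α-sep β-sep (a , b) (a′ , b′) agree =
  ×-≡,≡→≡ (a≡a′ , β-sep b b′ (λ v∈Y → α-inj a (β-agree v∈Y)))
  where
    a≡a′ : a ≡ a′
    a≡a′ = α-sep a a′ λ {v} v∈X → begin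
      α a v         ≡⟨ cong (α a) (β-fixes b v∈X) ⟨
      α a (β b v)   ≡⟨ agree (inj₁ v∈X) ⟩
      α a′ (β b′ v) ≡⟨ cong (α a′) (β-fixes b′ v∈X) ⟩
      α a′ v        ∎
      where open ≡-Reasoning
    β-agree : ∀ {v} → Y v → α a (β b v) ≡ α a (β b′ v)
    β-agree v∈Y = trans (agree (inj₂ v∈Y)) (cong (λ a″ → α a″ _) (sym a≡a′))

IsSubIso-id : ∀ {T} → IsSubIso T T id
IsSubIso-id = id , λ _ _ e → e

IsSubIso-∘ : ∀ {T U W f g} → IsSubIso U W f → IsSubIso T U g → IsSubIso T W (f ∘ g)
IsSubIso-∘ (f-inj , f-edge) (g-inj , g-edge) =
  g-inj ∘ f-inj , λ t₁ t₂ e → f-edge _ _ (g-edge t₁ t₂ e)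

module _ (T : Graph) where

  private
    Vertex = Fin (size T)

  transpose-preservesEdges : ∀ {x y} → StructEq T x y →
    ∀ t₁ t₂ → E T t₁ t₂ → E T (transpose x y t₁) (transpose x y t₂)
  transpose-preservesEdges {x} {y} (outside , xy⇔yx) t₁ t₂ e with t₁ ≟ x | t₂ ≟ x
  ... | yes refl | yes refl = ⊥-elim (loopless T t₁ e)
  ... | yes refl | no t₂≢x with t₂ ≟ y
  ...   | yes refl = to xy⇔yx e
  ...   | no t₂≢y  = to (proj₂ (outside t₂ t₂≢x t₂≢y)) e
  transpose-preservesEdges {x} {y} (outside , xy⇔yx) t₁ t₂ e | no t₁≢x | yes refl with t₁ ≟ y
  ... | yes refl = from xy⇔yx e
  ... | no t₁≢y  = to (proj₁ (outside t₁ t₁≢x t₁≢y)) e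
  transpose-preservesEdges {x} {y} (outside , xy⇔yx) t₁ t₂ e | no t₁≢x | no t₂≢x with t₁ ≟ y | t₂ ≟ y
  ... | yes refl | yes refl = ⊥-elim (loopless T t₁ e)
  ... | yes refl | no t₂≢y  = from (proj₂ (outside t₂ t₂≢x t₂≢y)) e
  ... | no t₁≢y  | yes refl = from (proj₁ (outside t₁ t₁≢x t₁≢y)) e
  ... | no t₁≢y  | no t₂≢y  = e

  transpose-IsSubIso : ∀ {x y} → StructEq T x y → IsSubIso T T (transpose x y)
  transpose-IsSubIso {x} {y} x∼y = transpose-injective x y , transpose-preservesEdges x∼y

  record Symmetries (S : Pred Vertex 0ℓ) (n : ℕ) : Set where
    field
      perm      : Fin n → Vertex → Vertex
      isSubIso  : ∀ a → IsSubIso T T (perm a)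
      fixes     : ∀ a {v} → ¬ S v → perm a v ≡ v
      separates : Separates S perm
  open Symmetries

  idSymmetries : ∀ {S} → Symmetries S 1
  idSymmetries = record
    { perm      = λ _ → id
    ; isSubIso  = λ _ → IsSubIso-id {T}
    ; fixes     = λ _ _ → refl
    ; separates = λ { zero zero _ → refl }
    }

  composeSymmetries : ∀ {A B S X : Pred Vertex 0ℓ} {m n} →
    (𝒜 : Symmetries A m) (ℬ : Symmetries B n) →
    A ⊆ S → B ⊆ S → X ⊆ A → X ⊆ ∁ B → Separates X (perm 𝒜) →
    Symmetries S (m * n)
  composeSymmetries {m = m} {n} 𝒜 ℬ A⊆S B⊆S X⊆A X⊆∁B X-separates = record
    { perm      = pairPerm ∘ remQuot {m} n
    ; isSubIso  = λ _ → IsSubIso-∘ {T} {T} {T} (isSubIso 𝒜 _) (isSubIso ℬ _)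
    ; fixes     = λ _ v∉S → trans (cong (perm 𝒜 _) (fixes ℬ _ (v∉S ∘ B⊆S))) (fixes 𝒜 _ (v∉S ∘ A⊆S))
    ; separates = Separates-reindex (remQuot-injective {m} n)
        (Separates-mono (λ { (inj₁ v∈X) → A⊆S (X⊆A v∈X) ; (inj₂ v∈B) → B⊆S v∈B })
          (Separates-∘ (proj₁ ∘ isSubIso 𝒜) (λ b v∈X → fixes ℬ b (X⊆∁B v∈X))
            X-separates (separates ℬ)))
    }
    where
      pairPerm : Fin m × Fin n → Vertex → Vertex
      pairPerm (a , b) = perm 𝒜 a ∘ perm ℬ b

  module _ {x : Vertex} {L : List Vertex} (x∷L-unique : Unique (x ∷ L))
           (equivalent : ∀ {y} → y ∈ x ∷ L → StructEq T x y) where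

    private
      target : Fin (suc (length L)) → Vertex
      target = lookup (x ∷ L)

    transposeWithX : Fin (suc (length L)) → Vertex → Vertex
    transposeWithX a = transpose x (target a)

    transposeWithX-separatedAtX : Separates (_≡ x) transposeWithX
    transposeWithX-separatedAtX a b agree = lookup-injective x∷L-unique (begin
      target a                 ≡⟨ transpose-matchˡ x (target a) ⟨
      transpose x (target a) x ≡⟨ agree refl ⟩
      transpose x (target b) x ≡⟨ transpose-matchˡ x (target b) ⟩
      target b                 ∎)
      where open ≡-Reasoning

    transpositions : Symmetries (_∈ x ∷ L) (suc (length L))
    transpositions = record
      { perm      = transposeWithX
      ; isSubIso  = λ a → transpose-IsSubIso (equivalent (∈-lookup a))
      ; fixes     = λ a v∉x∷L → transpose-other (v∉x∷L ∘ here)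
                                   (λ v≡y → v∉x∷L (subst (_∈ x ∷ L) (sym v≡y) (∈-lookup a)))
      ; separates = Separates-mono (λ { refl → here refl }) transposeWithX-separatedAtX
      }

  classSymmetries : (L : List Vertex) → Unique L → (∀ {v w} → v ∈ L → w ∈ L → StructEq T v w) →
    Symmetries (_∈ L) (length L !)
  classSymmetries []      _              _          = idSymmetries
  classSymmetries (x ∷ L) u@(x∉L ∷ u′) equivalent =
    composeSymmetries (transpositions u (equivalent (here refl)))
      (classSymmetries L u′ λ v∈L w∈L → equivalent (there v∈L) (there w∈L))
      id there (λ { refl → here refl }) (λ { refl → All¬⇒¬Any x∉L })
      (transposeWithX-separatedAtX u (equivalent (here refl)))

  module _ {k : ℕ} {c : Vertex → Fin k}
           (sameLabel⇒StructEq : ∀ {v w} → c v ≡ c w → StructEq T v w) where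

    labelClass : Fin k → List Vertex
    labelClass i = filter (λ v → c v ≟ i) (allFin (size T))

    ∈-labelClass⁻ : ∀ {v i} → v ∈ labelClass i → c v ≡ i
    ∈-labelClass⁻ v∈ = proj₂ (∈-filter⁻ (λ v → c v ≟ _) {xs = allFin (size T)} v∈)

    labelClassSymmetries : ∀ i → Symmetries (_∈ labelClass i) (classSize c i !)
    labelClassSymmetries i = classSymmetries (labelClass i) (filter⁺ (λ v → c v ≟ i) (allFin⁺ (size T)))
      λ v∈ w∈ → sameLabel⇒StructEq (trans (∈-labelClass⁻ v∈) (sym (∈-labelClass⁻ w∈)))

    labelledSymmetries : (is : List (Fin k)) → Unique is →
      Symmetries (λ v → c v ∈ is) (product (map (λ i → classSize c i !) is))
    labelledSymmetries []       _           = idSymmetries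
    labelledSymmetries (i ∷ is) (i∉is ∷ u) =
      composeSymmetries (labelClassSymmetries i) (labelledSymmetries is u)
        (here ∘ ∈-labelClass⁻) there id
        (λ v∈ cv∈is → All¬⇒¬Any i∉is (subst (_∈ is) (∈-labelClass⁻ v∈) cv∈is))
        (separates (labelClassSymmetries i))

open Symmetries

proposition3 : (T W : Graph) (k : ℕ) (c : Fin (size T) → Fin k) →
    IsClassPartition T k c →
    SubIso T W →
    Σ (Fin (prodFact c) → SubIso T W) λ g →
      ∀ i j → (∀ t → proj₁ (g i) t ≡ proj₁ (g j) t) → i ≡ j
proposition3 T W k c (_ , sameLabel⇔StructEq) (f , f-isSubIso@(f-injective , _)) =
  (λ a → f ∘ perm 𝒮 a , IsSubIso-∘ {T} {T} {W} f-isSubIso (isSubIso 𝒮 a)) ,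
  λ i j agree → separates 𝒮 i j λ {v} _ → f-injective (agree v)
  where
    𝒮 : Symmetries T (λ v → c v ∈ allFin k) (prodFact c)
    𝒮 = labelledSymmetries T (to (sameLabel⇔StructEq _ _)) (allFin k) (allFin⁺ k)
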